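{- For every $n\ge 5$, the cop number of the generalized Petersen graph $GP(n,2)$ is at most $3$. Moreover, if $n\notin\{6,8\}$ (equivalently, if $GP(n,2)$ has girth $5$), then the cop number of $GP(n,2)$ is exactly $3$.
   Context: For $n\ge 5$ and $1\le k<n/2$, the generalized Petersen graph $GP(n,k)$ has vertex set $\{a_0,\dots,a_{n-1},b_0,\dots,b_{n-1}\}$ and edge set $\{a_ia_{i+1},\ a_ib_i,\ b_ib_{i+k}: 0\le i\le n-1\}$, subscripts modulo $n$. Cops and robbers: cops are placed first, then the robber; players alternate, cops first; each pawn stays or moves to an adjacent vertex (all cops may move on the cops' turn); perfect information; cops win if a cop occupies the robber's vertex in finitely many moves. The cop number is the least number of cops that can guarantee capture. The girth is the length of a shortest cycle. -}

module Defs where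

open import Level using (0ℓ)
open import Data.Nat using (ℕ; zero; suc; _+_; _%_; _≤_; _<_)
open import Data.Fin using (Fin; toℕ)
open import Data.Sum using (_⊎_; inj₁; inj₂)
open import Data.Product using (Σ; ∃; _×_; _,_)
open import Data.Empty using (⊥)
open import Relation.Nullary using (¬_)
open import Relation.Binary.PropositionalEquality using (_≡_)

record Graph : Set₁ where
  field
    V   : Set
    Adj : V → V → Set
open Graph public

addMod : (n : ℕ) → Fin n → ℕ → ℕ
addMod zero    ()
addMod (suc m) i s = (toℕ i + s) % suc m

-- Vertices of GP(n,k): inj₁ i = a_i (outer), inj₂ i = b_i (inner).
GPV : ℕ → Set
GPV n = Fin n ⊎ Fin n

-- Generating (directed) edge set {a_i a_{i+1}, a_i b_i, b_i b_{i+k}}.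
GPEdge : (n k : ℕ) → GPV n → GPV n → Set
GPEdge n k (inj₁ i) (inj₁ j) = toℕ j ≡ addMod n i 1
GPEdge n k (inj₁ i) (inj₂ j) = i ≡ j
GPEdge n k (inj₂ i) (inj₁ j) = ⊥
GPEdge n k (inj₂ i) (inj₂ j) = toℕ j ≡ addMod n i k

GP : ℕ → ℕ → Graph
GP n k = record
  { V   = GPV n
  ; Adj = λ u v → GPEdge n k u v ⊎ GPEdge n k v u
  }

module _ (G : Graph) where
  Step : V G → V G → Set
  Step u v = (u ≡ v) ⊎ Adj G u v

  Config : ℕ → Set
  Config c = Fin c → V G

  Caught : {c : ℕ} → Config c → V G → Set
  Caught {c} cs r = ∃ λ (i : Fin c) → cs i ≡ r

  -- CopsWin cs r : it is the cops' turn, cops at cs, robber at r, and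
  -- the cops can force capture in finitely many moves (inductive = finite).
  data CopsWin {c : ℕ} : Config c → V G → Set where
    caught : ∀ {cs r} → Caught cs r → CopsWin cs r
    move   : ∀ {cs r} (cs' : Config c) →
             (∀ i → Step (cs i) (cs' i)) →
             (Caught cs' r ⊎ (∀ r' → Step r r' → CopsWin cs' r')) →
             CopsWin cs r

  -- c cops win: cops placed first, then the robber, then cops move first.
  CopsWinGame : ℕ → Set
  CopsWinGame c = Σ (Config c) λ cs → ∀ (r : V G) → CopsWin cs r

  CopNumber≤ : ℕ → Set
  CopNumber≤ m = ∃ λ c → c ≤ m × CopsWinGame c

  CopNumber≡ : ℕ → Set
  CopNumber≡ m = CopsWinGame m × (∀ c → c < m → ¬ CopsWinGame c)

-- Upper bound: one cop holds the outer cycle at a_j while two cops sit on b_{w+j} and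
-- b_{w+1+j}; as inner edges join b_i to b_{i±2}, this pair cuts every inner path, so the
-- robber is confined to the strip of positions between j and w + j. Each round the upper
-- barrier cop jumps two steps down past the lower one, shrinking the strip. The one leak
-- is b_{1+j}, whose inner neighbour b_{j-1} lies behind the outer cop; while the robber
-- sits there, all three cops step one position down instead, which shrinks the strip too.
--
-- Lower bound: GP(n,2) is cubic and, for n ∉ {6, 8}, has girth five, so two distinct
-- neighbours of a vertex r have no common neighbour other than r. Each of two cops then
-- guards at most one of the three neighbours of the robber, who can always move to an
-- unguarded vertex.
module Submission where

open import Defs
open import Data.Bool using (Bool; true; false; not)
open import Data.Empty using (⊥; ⊥-elim)
open import Data.Fin as Fin using (Fin; toℕ; zero; suc)
open import Data.Fin.Properties using (toℕ-injective; toℕ<n; toℕ-fromℕ<)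
open import Data.List using (List; []; _∷_; map)
import Data.List.Relation.Unary.All as All
open import Data.List.Relation.Unary.Any using (here; there)
open import Data.List.Membership.Propositional using (_∈_)
open import Data.List.Membership.Propositional.Properties using (∈-map⁻)
open import Data.Nat
open import Data.Nat.Properties
open import Data.Nat.DivMod
open import Data.Nat.Divisibility
open import Data.List.Membership.DecPropositional _≟_ using (_∈?_)
open import Data.Product using (∃; _×_; _,_)
open import Data.Product.Properties using () renaming (≡-dec to ×-≡-dec)
open import Data.Sum using (_⊎_; inj₁; inj₂)
open import Data.Sum.Properties using (inj₁-injective; inj₂-injective) renaming (≡-dec to ⊎-≡-dec)
open import Data.Vec.Functional as Vector using (updateAt)
open import Data.Vec.Functional.Properties using (updateAt-updates; updateAt-minimal)
open import Function using (_∘_)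
open import Relation.Binary.Definitions using (DecidableEquality)
open import Relation.Binary.PropositionalEquality
open import Relation.Nullary using (¬_; Dec; yes; no)
open import Relation.Nullary.Decidable using (True; toWitness; ¬?; _⊎-dec_; _×-dec_)

module _ {n : ℕ} .{{_ : NonZero n}} where

  %≡%⇒∣∣-∣ : ∀ {x y} → x % n ≡ y % n → n ∣ ∣ x - y ∣
  %≡%⇒∣∣-∣ {x} {y} eq = subst (n ∣_) (sym distance) (n∣m*n ∣ x / n - y / n ∣)
    where
    open ≡-Reasoning
    distance : ∣ x - y ∣ ≡ ∣ x / n - y / n ∣ * n
    distance = begin
      ∣ x - y ∣                                  ≡⟨ cong₂ ∣_-_∣ (m≡m%n+[m/n]*n x n) (m≡m%n+[m/n]*n y n) ⟩
      ∣ x % n + x / n * n - y % n + y / n * n ∣  ≡⟨ cong (λ r → ∣ x % n + x / n * n - r + y / n * n ∣) (sym eq) ⟩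
      ∣ x % n + x / n * n - x % n + y / n * n ∣  ≡⟨ ∣m+n-m+o∣≡∣n-o∣ (x % n) _ _ ⟩
      ∣ x / n * n - y / n * n ∣                  ≡⟨ *-distribʳ-∣-∣ n (x / n) (y / n) ⟨
      ∣ x / n - y / n ∣ * n                      ∎

  ∣∸⇒%≡% : ∀ {x y} → x ≤ y → n ∣ y ∸ x → x % n ≡ y % n
  ∣∸⇒%≡% {x} x≤y n∣y∸x = trans (sym (%-remove-+ʳ x n∣y∸x)) (cong (_% n) (m+[n∸m]≡n x≤y))

  ∣∣-∣⇒%≡% : ∀ {x y} → n ∣ ∣ x - y ∣ → x % n ≡ y % n
  ∣∣-∣⇒%≡% {x} {y} n∣d with ≤-total x y
  ... | inj₁ x≤y = ∣∸⇒%≡% x≤y (subst (n ∣_) (m≤n⇒∣m-n∣≡n∸m x≤y) n∣d)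
  ... | inj₂ y≤x = sym (∣∸⇒%≡% y≤x (subst (n ∣_) (m≤n⇒∣n-m∣≡n∸m y≤x) n∣d))

  %-cong-+ˡ : ∀ c {x y} → x % n ≡ y % n → (c + x) % n ≡ (c + y) % n
  %-cong-+ˡ c {x} {y} eq = ∣∣-∣⇒%≡% (subst (n ∣_) (sym (∣m+n-m+o∣≡∣n-o∣ c x y)) (%≡%⇒∣∣-∣ eq))

  %-cancelˡ : ∀ c {x y} → (c + x) % n ≡ (c + y) % n → x % n ≡ y % n
  %-cancelˡ c {x} {y} eq = ∣∣-∣⇒%≡% (subst (n ∣_) (∣m+n-m+o∣≡∣n-o∣ c x y) (%≡%⇒∣∣-∣ eq))

m≤n⇒∃[o]o+m≡n : ∀ {m n} → m ≤ n → ∃ λ o → o + m ≡ n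
m≤n⇒∃[o]o+m≡n {m} m≤n with m≤n⇒∃[o]m+o≡n m≤n
... | o , m+o≡n = o , trans (+-comm o m) m+o≡n

≡⊎≡⊎≡⊎≡⇒∈ : ∀ {A : Set} {v p₁ p₂ p₃ p₄ : A} →
            v ≡ p₁ ⊎ v ≡ p₂ ⊎ v ≡ p₃ ⊎ v ≡ p₄ → v ∈ p₁ ∷ p₂ ∷ p₃ ∷ p₄ ∷ []
≡⊎≡⊎≡⊎≡⇒∈ (inj₁ eq)               = here eq
≡⊎≡⊎≡⊎≡⇒∈ (inj₂ (inj₁ eq))        = there (here eq)
≡⊎≡⊎≡⊎≡⇒∈ (inj₂ (inj₂ (inj₁ eq))) = there (there (here eq))
≡⊎≡⊎≡⊎≡⇒∈ (inj₂ (inj₂ (inj₂ eq))) = there (there (there (here eq)))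

avoid-two : ∀ {A : Set} → DecidableEquality A → {v₁ v₂ v₃ : A} →
            v₁ ≢ v₂ → v₁ ≢ v₃ → v₂ ≢ v₃ → ∀ x y → ∃ λ r → x ≢ r × y ≢ r
avoid-two _≟_ {v₁} {v₂} {v₃} v₁≢v₂ v₁≢v₃ v₂≢v₃ x y with x ≟ v₁ | y ≟ v₁
... | no x≢v₁  | no y≢v₁ = v₁ , x≢v₁ , y≢v₁
... | yes refl | _ with y ≟ v₂
...   | no y≢v₂  = v₂ , v₁≢v₂ , y≢v₂
...   | yes refl = v₃ , v₁≢v₃ , v₂≢v₃
avoid-two _≟_ {v₁} {v₂} {v₃} v₁≢v₂ v₁≢v₃ v₂≢v₃ x y | no _ | yes refl with x ≟ v₂
...   | no x≢v₂  = v₂ , x≢v₂ , v₁≢v₂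
...   | yes refl = v₃ , v₂≢v₃ , v₁≢v₃

module Game (G : Graph) where

  Threatened : ∀ {c} → Config G c → V G → Set
  Threatened cs r = ∃ λ i → Step G (cs i) r

  capture : ∀ {c} {cs : Config G c} {r} → Threatened cs r → CopsWin G cs r
  capture {cs = cs} {r} (i , cs-i→r) = move cs′ steps (inj₁ (i , updateAt-updates i cs))
    where
    cs′ : Config G _
    cs′ = updateAt cs i (λ _ → r)
    steps : ∀ k → Step G (cs k) (cs′ k)
    steps k with k Fin.≟ i
    ... | yes refl = subst (Step G (cs k)) (sym (updateAt-updates k cs)) cs-i→r
    ... | no k≢i   = inj₁ (sym (updateAt-minimal k i cs k≢i))

  extend-steps : ∀ {c} {cs cs′ : Config G c} {v} → (∀ i → Step G (cs i) (cs′ i)) →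
                 ∀ i → Step G ((v Vector.∷ cs) i) ((v Vector.∷ cs′) i)
  extend-steps steps zero    = inj₁ refl
  extend-steps steps (suc i) = steps i

  CopsWin-extend : ∀ {c} {cs : Config G c} {r} v → CopsWin G cs r → CopsWin G (v Vector.∷ cs) r
  CopsWin-extend v (caught (i , cs-i≡r)) = caught (suc i , cs-i≡r)
  CopsWin-extend v (move cs′ steps (inj₁ (i , cs′-i≡r))) =
    move (v Vector.∷ cs′) (extend-steps steps) (inj₁ (suc i , cs′-i≡r))
  CopsWin-extend v (move cs′ steps (inj₂ next)) =
    move (v Vector.∷ cs′) (extend-steps steps) (inj₂ λ r′ s → CopsWin-extend v (next r′ s))

  CopsWinGame-mono : ∀ {c} d → c ≤ d → V G → CopsWinGame G c → CopsWinGame G d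
  CopsWinGame-mono d c≤d v win with m≤n⇒m<n∨m≡n c≤d
  ... | inj₂ refl = win
  ... | inj₁ (s≤s {n = d′} c≤d′) with CopsWinGame-mono d′ c≤d′ v win
  ...   | cs , wins = v Vector.∷ cs , λ r → CopsWin-extend v (wins r)

module Evasion (G : Graph) (step? : ∀ u v → Dec (Step G u v)) where

  record Branching (r : V G) : Set where
    field
      {u₁ u₂ u₃} : V G
      r→u₁ : Step G r u₁
      r→u₂ : Step G r u₂
      r→u₃ : Step G r u₃
      meet₁₂ : ∀ {z} → Step G z u₁ → Step G z u₂ → z ≡ r
      meet₁₃ : ∀ {z} → Step G z u₁ → Step G z u₃ → z ≡ r
      meet₂₃ : ∀ {z} → Step G z u₂ → Step G z u₃ → z ≡ r

  Unguarded : ∀ {c} → Config G c → V G → Set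
  Unguarded cs r = ∀ i → ¬ Step G (cs i) r

  Covered : V G → V G → V G → Set
  Covered x y u = Step G x u ⊎ Step G y u

  covered? : ∀ x y u → Dec (Covered x y u)
  covered? x y u = step? x u ⊎-dec step? y u

  module _ {r} (br : Branching r) where
    open Branching br

    escape : ∀ {x y} → x ≢ r → y ≢ r → ∃ λ u → Step G r u × ¬ Step G x u × ¬ Step G y u
    escape {x} {y} x≢r y≢r with covered? x y u₁ | covered? x y u₂ | covered? x y u₃
    ... | no free | _       | _       = u₁ , r→u₁ , free ∘ inj₁ , free ∘ inj₂
    ... | yes _   | no free | _       = u₂ , r→u₂ , free ∘ inj₁ , free ∘ inj₂
    ... | yes _   | yes _   | no free = u₃ , r→u₃ , free ∘ inj₁ , free ∘ inj₂
    ... | yes c₁  | yes c₂  | yes c₃  = ⊥-elim (pigeonhole c₁ c₂ c₃)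
      where
      pigeonhole : Covered x y u₁ → Covered x y u₂ → Covered x y u₃ → ⊥
      pigeonhole (inj₁ s₁) (inj₁ s₂) _         = x≢r (meet₁₂ s₁ s₂)
      pigeonhole (inj₂ s₁) (inj₂ s₂) _         = y≢r (meet₁₂ s₁ s₂)
      pigeonhole (inj₁ s₁) (inj₂ _)  (inj₁ s₃) = x≢r (meet₁₃ s₁ s₃)
      pigeonhole (inj₁ _)  (inj₂ s₂) (inj₂ s₃) = y≢r (meet₂₃ s₂ s₃)
      pigeonhole (inj₂ _)  (inj₁ s₂) (inj₁ s₃) = x≢r (meet₂₃ s₂ s₃)
      pigeonhole (inj₂ s₁) (inj₁ _)  (inj₂ s₃) = y≢r (meet₁₃ s₁ s₃)

  never-caught : (∀ r → Branching r) → ∀ {cs : Config G 2} {r} → CopsWin G cs r → ¬ Unguarded cs r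
  never-caught br (caught (i , cs-i≡r)) unguarded = unguarded i (inj₁ cs-i≡r)
  never-caught br (move cs′ steps (inj₁ (i , cs′-i≡r))) unguarded =
    unguarded i (subst (Step G _) cs′-i≡r (steps i))
  never-caught br {r = r} (move cs′ steps (inj₂ next)) unguarded
    with escape (br r) (vacated zero) (vacated (suc zero))
    where
    vacated : ∀ i → cs′ i ≢ r
    vacated i cs′-i≡r = unguarded i (subst (Step G _) cs′-i≡r (steps i))
  ... | u , r→u , ¬x→u , ¬y→u = never-caught br (next u r→u) λ { zero → ¬x→u ; (suc zero) → ¬y→u }

  two-cops-lose : (∀ r → Branching r) → (∀ x y → ∃ λ r → x ≢ r × y ≢ r) → ¬ CopsWinGame G 2
  two-cops-lose br free (cs , wins) with free (cs zero) (cs (suc zero))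
  ... | r , x≢r , y≢r with escape (br r) x≢r y≢r
  ...   | u , _ , ¬x→u , ¬y→u = never-caught br (wins u) λ { zero → ¬x→u ; (suc zero) → ¬y→u }

module GP₂ (m : ℕ) where

  n : ℕ
  n = suc m

  G : Graph
  G = GP n 2

  data Side : Set where
    outer inner : Side

  _≟ₛ_ : DecidableEquality Side
  outer ≟ₛ outer = yes refl
  inner ≟ₛ inner = yes refl
  outer ≟ₛ inner = no λ ()
  inner ≟ₛ outer = no λ ()

  vertex : Side → Fin n → V G
  vertex outer = inj₁
  vertex inner = inj₂

  at : Side → ℕ → V G
  at s x = vertex s (x mod n)

  a b : ℕ → V G
  a = at outer
  b = at inner

  toℕ-mod : ∀ x → toℕ (x mod n) ≡ x % n
  toℕ-mod x = toℕ-fromℕ< _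

  at-toℕ : ∀ s (i : Fin n) → at s (toℕ i) ≡ vertex s i
  at-toℕ s i = cong (vertex s) (toℕ-injective (trans (toℕ-mod (toℕ i)) (m<n⇒m%n≡m (toℕ<n i))))

  at-cong : ∀ s {x y} → x % n ≡ y % n → at s x ≡ at s y
  at-cong s {x} {y} eq = cong (vertex s) (toℕ-injective (trans (toℕ-mod x) (trans eq (sym (toℕ-mod y)))))

  at-injective : ∀ s {x y} → at s x ≡ at s y → x % n ≡ y % n
  at-injective s {x} {y} eq = trans (sym (toℕ-mod x)) (trans (cong toℕ (index-injective s eq)) (toℕ-mod y))
    where
    index-injective : ∀ s → vertex s (x mod n) ≡ vertex s (y mod n) → x mod n ≡ y mod n
    index-injective outer = inj₁-injective
    index-injective inner = inj₂-injective

  at-side : ∀ {s s′ x y} → at s x ≡ at s′ y → s ≡ s′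
  at-side {outer} {outer} _ = refl
  at-side {inner} {inner} _ = refl
  at-side {outer} {inner} ()
  at-side {inner} {outer} ()

  at-periodic : ∀ s x → at s (n + x) ≡ at s x
  at-periodic s x = at-cong s {n + x} {x} (%-remove-+ˡ {n} x ∣-refl)

  addMod-mod : ∀ x k → addMod n (x mod n) k ≡ toℕ ((k + x) mod n)
  addMod-mod x k = begin
    (toℕ (x mod n) + k) % n  ≡⟨ cong (λ t → (t + k) % n) (toℕ-mod x) ⟩
    (x % n + k) % n          ≡⟨ cong (_% n) (+-comm (x % n) k) ⟩
    (k + x % n) % n          ≡⟨ %-cong-+ˡ k (m%n%n≡m%n x n) ⟩
    (k + x) % n              ≡⟨ toℕ-mod (k + x) ⟨
    toℕ ((k + x) mod n)      ∎
    where open ≡-Reasoning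

  addMod-injective : ∀ {i j : Fin n} k → addMod n i k ≡ addMod n j k → i ≡ j
  addMod-injective {i} {j} k eq = toℕ-injective (begin
    toℕ i      ≡⟨ m<n⇒m%n≡m (toℕ<n i) ⟨
    toℕ i % n  ≡⟨ %-cancelˡ k (subst₂ (λ y z → y % n ≡ z % n) (+-comm (toℕ i) k) (+-comm (toℕ j) k) eq) ⟩
    toℕ j % n  ≡⟨ m<n⇒m%n≡m (toℕ<n j) ⟩
    toℕ j      ∎)
    where open ≡-Reasoning

  toℕ≡addMod⇒≡mod : ∀ {i} x k → toℕ i ≡ addMod n (x mod n) k → i ≡ (k + x) mod n
  toℕ≡addMod⇒≡mod x k eq = toℕ-injective (trans eq (addMod-mod x k))

  mod≡addMod⇒≡mod : ∀ {i} y k → toℕ ((k + y) mod n) ≡ addMod n i k → i ≡ y mod n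
  mod≡addMod⇒≡mod y k eq = addMod-injective k (trans (sym eq) (sym (addMod-mod y k)))

  step-sym : ∀ {u v} → Step G u v → Step G v u
  step-sym (inj₁ eq)       = inj₁ (sym eq)
  step-sym (inj₂ (inj₁ e)) = inj₂ (inj₂ e)
  step-sym (inj₂ (inj₂ e)) = inj₂ (inj₁ e)

  outer-edge : ∀ x → Step G (a x) (a (1 + x))
  outer-edge x = inj₂ (inj₁ (sym (addMod-mod x 1)))

  spoke : ∀ x → Step G (a x) (b x)
  spoke x = inj₂ (inj₁ refl)

  inner-edge : ∀ x → Step G (b x) (b (2 + x))
  inner-edge x = inj₂ (inj₁ (sym (addMod-mod x 2)))

  outer-nbhd : ∀ y {v} → Step G (a (1 + y)) v →
               v ≡ a (1 + y) ⊎ v ≡ a (2 + y) ⊎ v ≡ a y ⊎ v ≡ b (1 + y)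
  outer-nbhd y (inj₁ eq)                = inj₁ (sym eq)
  outer-nbhd y {inj₁ i} (inj₂ (inj₁ e)) = inj₂ (inj₁ (cong inj₁ (toℕ≡addMod⇒≡mod (1 + y) 1 e)))
  outer-nbhd y {inj₂ i} (inj₂ (inj₁ e)) = inj₂ (inj₂ (inj₂ (cong inj₂ (sym e))))
  outer-nbhd y {inj₁ i} (inj₂ (inj₂ e)) = inj₂ (inj₂ (inj₁ (cong inj₁ (mod≡addMod⇒≡mod y 1 e))))
  outer-nbhd y {inj₂ i} (inj₂ (inj₂ ()))

  inner-nbhd : ∀ y {v} → Step G (b (2 + y)) v →
               v ≡ b (2 + y) ⊎ v ≡ b (4 + y) ⊎ v ≡ b y ⊎ v ≡ a (2 + y)
  inner-nbhd y (inj₁ eq)                = inj₁ (sym eq)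
  inner-nbhd y {inj₂ i} (inj₂ (inj₁ e)) = inj₂ (inj₁ (cong inj₂ (toℕ≡addMod⇒≡mod (2 + y) 2 e)))
  inner-nbhd y {inj₁ i} (inj₂ (inj₁ ()))
  inner-nbhd y {inj₁ i} (inj₂ (inj₂ e)) = inj₂ (inj₂ (inj₂ (cong inj₁ e)))
  inner-nbhd y {inj₂ i} (inj₂ (inj₂ e)) = inj₂ (inj₂ (inj₁ (cong inj₂ (mod≡addMod⇒≡mod y 2 e))))

  shift : ∀ s x j → at s (suc x + (m + j)) ≡ at s (x + j)
  shift s x j = trans (cong (at s ∘ suc) x+[m+j]≡m+[x+j]) (at-periodic s (x + j))
    where
    x+[m+j]≡m+[x+j] : x + (m + j) ≡ m + (x + j)
    x+[m+j]≡m+[x+j] = trans (sym (+-assoc x m j)) (trans (cong (_+ j) (+-comm x m)) (+-assoc m x j))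

  outer-back : ∀ j → Step G (a j) (a (m + j))
  outer-back j = step-sym (subst (Step G (a (m + j))) (shift outer 0 j) (outer-edge (m + j)))

  inner-back : ∀ x j → Step G (b (suc x + j)) (b (x + (m + j)))
  inner-back x j =
    step-sym (subst (Step G (b (x + (m + j)))) (shift inner (suc x) j) (inner-edge (x + (m + j))))

  edge? : ∀ u v → Dec (GPEdge n 2 u v)
  edge? (inj₁ i) (inj₁ j) = toℕ j ≟ addMod n i 1
  edge? (inj₁ i) (inj₂ j) = i Fin.≟ j
  edge? (inj₂ i) (inj₁ j) = no λ ()
  edge? (inj₂ i) (inj₂ j) = toℕ j ≟ addMod n i 2

  _≟ᵥ_ : DecidableEquality (V G)
  _≟ᵥ_ = ⊎-≡-dec Fin._≟_ Fin._≟_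

  step? : ∀ u v → Dec (Step G u v)
  step? u v = (u ≟ᵥ v) ⊎-dec (edge? u v ⊎-dec edge? v u)

module UpperBound (k : ℕ) where
  open GP₂ (4 + k)
  open Game G

  -- n - 1, so that m + j is the position preceding j
  m : ℕ
  m = 4 + k

  -- The Bool records which of the two barrier cops is currently the lower one.
  guard : ℕ → ℕ → Bool → Config G 3
  guard j w e     zero             = a j
  guard j w false (suc zero)       = b (w + j)
  guard j w false (suc (suc zero)) = b (suc w + j)
  guard j w true  (suc zero)       = b (suc w + j)
  guard j w true  (suc (suc zero)) = b (w + j)

  lower-cop : ∀ {j w e v} → Step G (b (w + j)) v → Threatened (guard j w e) v
  lower-cop {e = false} s = suc zero , s
  lower-cop {e = true}  s = suc (suc zero) , s

  upper-cop : ∀ {j w e v} → Step G (b (suc w + j)) v → Threatened (guard j w e) v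
  upper-cop {e = false} s = suc (suc zero) , s
  upper-cop {e = true}  s = suc zero , s

  data Trapped (j w : ℕ) : V G → Set where
    outer-trapped : ∀ d → 3 + d ≤ w → Trapped j w (a (2 + d + j))
    inner-trapped : ∀ d → 4 + d ≤ w → Trapped j w (b (2 + d + j))
    corner        : 3 ≤ w → Trapped j w (b (1 + j))

  data Doomed (j w : ℕ) (e : Bool) (v : V G) : Set where
    trapped    : Trapped j w v → Doomed j w e v
    threatened : Threatened (guard j w e) v → Doomed j w e v

  Response : ℕ → ℕ → Bool → V G → Set
  Response j w e v = ∀ {v′} → Step G v v′ → Doomed j w e v′

  outer-down : ∀ {j w e} d → 2 + d ≤ w → Doomed j w e (a (1 + d + j))
  outer-down {j} zero    _ = threatened (zero , outer-edge j)
  outer-down     (suc d) p = trapped (outer-trapped d p)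

  inner-down : ∀ {j w e} d → 3 + d ≤ w → Doomed j w e (b (d + j))
  inner-down {j} zero          _ = threatened (zero , spoke j)
  inner-down     (suc zero)    p = trapped (corner (m+n≤o⇒n≤o 1 p))
  inner-down     (suc (suc d)) p = trapped (inner-trapped d (m+n≤o⇒n≤o 1 p))

  outer-response : ∀ {d j w e} → 2 + d ≤ w → Response j w e (a (2 + d + j))
  outer-response {d} {j} p s with m≤n⇒∃[o]o+m≡n p | outer-nbhd (1 + d + j) s
  ... | 0           , refl | inj₁ refl               = threatened (lower-cop (step-sym (spoke (2 + d + j))))
  ... | suc t       , refl | inj₁ refl               = trapped (outer-trapped d (s≤s (m≤n+m _ t)))
  ... | 0           , refl | inj₂ (inj₁ refl)        = threatened (upper-cop (step-sym (spoke (3 + d + j))))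
  ... | 1           , refl | inj₂ (inj₁ refl)        = threatened (lower-cop (step-sym (spoke (3 + d + j))))
  ... | suc (suc t) , refl | inj₂ (inj₁ refl)        = trapped (outer-trapped (1 + d) (s≤s (s≤s (m≤n+m _ t))))
  ... | _                  | inj₂ (inj₂ (inj₁ refl)) = outer-down d p
  ... | 0           , refl | inj₂ (inj₂ (inj₂ refl)) = threatened (lower-cop (inj₁ refl))
  ... | 1           , refl | inj₂ (inj₂ (inj₂ refl)) = threatened (upper-cop (step-sym (inner-edge (2 + d + j))))
  ... | suc (suc t) , refl | inj₂ (inj₂ (inj₂ refl)) = trapped (inner-trapped d (s≤s (s≤s (m≤n+m _ t))))

  inner-response : ∀ {d j w e} → 3 + d ≤ w → Response j w e (b (2 + d + j))
  inner-response {d} {j} p s with m≤n⇒∃[o]o+m≡n p | inner-nbhd (d + j) s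
  ... | 0                 , refl | inj₁ refl        = threatened (upper-cop (step-sym (inner-edge (2 + d + j))))
  ... | suc t             , refl | inj₁ refl        = trapped (inner-trapped d (s≤s (m≤n+m _ t)))
  ... | 0                 , refl | inj₂ (inj₁ refl) = threatened (upper-cop (inj₁ refl))
  ... | 1                 , refl | inj₂ (inj₁ refl) = threatened (lower-cop (inj₁ refl))
  ... | 2                 , refl | inj₂ (inj₁ refl) = threatened (upper-cop (step-sym (inner-edge (4 + d + j))))
  ... | suc (suc (suc t)) , refl | inj₂ (inj₁ refl) =
    trapped (inner-trapped (2 + d) (s≤s (s≤s (s≤s (m≤n+m _ t)))))
  ... | _ | inj₂ (inj₂ (inj₁ refl)) = inner-down d p
  ... | _ | inj₂ (inj₂ (inj₂ refl)) = trapped (outer-trapped d p)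

  advance-steps : ∀ j w e i → Step G (guard j (suc w) e i) (guard j w (not e) i)
  advance-steps j w e     zero             = inj₁ refl
  advance-steps j w false (suc zero)       = inj₁ refl
  advance-steps j w false (suc (suc zero)) = step-sym (inner-edge (w + j))
  advance-steps j w true  (suc zero)       = step-sym (inner-edge (w + j))
  advance-steps j w true  (suc (suc zero)) = inj₁ refl

  rebase-steps : ∀ j w e i → Step G (guard j (suc w) e i) (guard (m + j) w e i)
  rebase-steps j w e     zero             = outer-back j
  rebase-steps j w false (suc zero)       = inner-back w j
  rebase-steps j w false (suc (suc zero)) = inner-back (suc w) j
  rebase-steps j w true  (suc zero)       = inner-back (suc w) j
  rebase-steps j w true  (suc (suc zero)) = inner-back w j

  mutual
    chase : ∀ {j w e v} → Trapped j w v → CopsWin G (guard j w e) v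
    chase {j} {suc w} {e} (outer-trapped d (s≤s p)) =
      move-to-guard j w (not e) (advance-steps j w e) (outer-response p)
    chase {j} {suc w} {e} (inner-trapped d (s≤s p)) =
      move-to-guard j w (not e) (advance-steps j w e) (inner-response p)
    chase {j} {suc w} {e} (corner (s≤s p)) with m≤n⇒m<n∨m≡n p
    ... | inj₂ refl = capture (lower-cop {e = e} (step-sym (inner-edge (1 + j))))
    ... | inj₁ 3≤w  = move-to-guard (m + j) w e (rebase-steps j w e) λ {v′} s →
                        inner-response {0} {m + j} 3≤w (subst (λ u → Step G u v′) (sym (shift inner 1 j)) s)

    move-to-guard : ∀ {cs : Config G 3} {v} j w e → (∀ i → Step G (cs i) (guard j w e i)) →
                    Response j w e v → CopsWin G cs v
    move-to-guard j w e steps response = move _ steps (inj₂ λ v′ s → doomed-wins (response s))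

    doomed-wins : ∀ {j w e v} → Doomed j w e v → CopsWin G (guard j w e) v
    doomed-wins {e = e} (trapped t) = chase {e = e} t
    doomed-wins (threatened th)     = capture th

  w₀ : ℕ
  w₀ = 3 + k

  -- Stated for a (x + 0) so that the offsets match the strip with j = 0.
  outer-start : ∀ x → x ≤ suc w₀ → Doomed 0 w₀ false (a (x + 0))
  outer-start 0             _ = threatened (zero , inj₁ refl)
  outer-start 1             _ = threatened (zero , outer-edge 0)
  outer-start (suc (suc d)) p with m≤n⇒m<n∨m≡n p
  ... | inj₁ (s≤s p′) = outer-response p′ (inj₁ refl)
  ... | inj₂ refl     = threatened (upper-cop (step-sym (spoke (suc w₀ + 0))))

  inner-start : ∀ x → x ≤ suc w₀ → Doomed 0 w₀ false (b (x + 0))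
  inner-start 0             _ = threatened (zero , spoke 0)
  inner-start 1             _ = trapped (corner (m≤m+n 3 k))
  inner-start (suc (suc d)) p with m≤n⇒m<n∨m≡n p
  ... | inj₂ refl = threatened (upper-cop (inj₁ refl))
  ... | inj₁ (s≤s p′) with m≤n⇒m<n∨m≡n p′
  ...   | inj₂ refl = threatened (lower-cop (inj₁ refl))
  ...   | inj₁ p″   = inner-response p″ (inj₁ refl)

  three-cops-win : CopsWinGame G 3
  three-cops-win = guard 0 w₀ false , λ v → doomed-wins (initial v)
    where
    vertex-at : ∀ s (i : Fin n) → at s (toℕ i + 0) ≡ vertex s i
    vertex-at s i = trans (cong (at s) (+-identityʳ (toℕ i))) (at-toℕ s i)
    initial : ∀ v → Doomed 0 w₀ false v
    initial (inj₁ i) =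
      subst (Doomed 0 w₀ false) (vertex-at outer i) (outer-start (toℕ i) (s≤s⁻¹ (toℕ<n i)))
    initial (inj₂ i) =
      subst (Doomed 0 w₀ false) (vertex-at inner i) (inner-start (toℕ i) (s≤s⁻¹ (toℕ<n i)))

-- The differences between positions of same-side vertices in the closed neighbourhoods of
-- two neighbours of a common vertex; for n ≥ 5 none of them is a multiple of n unless n ∈ {6, 8}.
shortGaps : List ℕ
shortGaps = 1 ∷ 2 ∷ 3 ∷ 4 ∷ 6 ∷ 8 ∷ []

shortGaps-nonmultiples : ∀ k → 5 + k ≢ 6 → 5 + k ≢ 8 → All.All (λ d → ¬ 5 + k ∣ d) shortGaps
shortGaps-nonmultiples 0 _   _   = toWitness {a? = All.all? (λ d → ¬? (5 ∣? d)) shortGaps} _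
shortGaps-nonmultiples 1 n≢6 _   = ⊥-elim (n≢6 refl)
shortGaps-nonmultiples 2 _   _   = toWitness {a? = All.all? (λ d → ¬? (7 ∣? d)) shortGaps} _
shortGaps-nonmultiples 3 _   n≢8 = ⊥-elim (n≢8 refl)
shortGaps-nonmultiples (suc (suc (suc (suc k)))) _ _ = All.map below-n in-range
  where
  in-range : All.All (λ d → 0 < d × d < 9) shortGaps
  in-range = toWitness {a? = All.all? (λ d → (0 <? d) ×-dec (d <? 9)) shortGaps} _
  below-n : ∀ {d} → 0 < d × d < 9 → ¬ 9 + k ∣ d
  below-n (0<d , d<9) n∣d = <⇒≱ d<9 (≤-trans (m≤m+n 9 k) (∣⇒≤ ⦃ >-nonZero 0<d ⦄ n∣d))

module LowerBound (k : ℕ) (n≢6 : 5 + k ≢ 6) (n≢8 : 5 + k ≢ 8) where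
  open GP₂ (4 + k)
  open Game G
  open Evasion G step?

  Local : Set
  Local = Side × ℕ

  _≟ₗ_ : DecidableEquality Local
  _≟ₗ_ = ×-≡-dec _≟ₛ_ _≟_

  ⟦_⟧ : Local → ℕ → V G
  ⟦ s , c ⟧ x = at s (c + x)

  Apart : Local → Local → Set
  Apart (s , c) (s′ , c′) = s ≢ s′ ⊎ ∣ c - c′ ∣ ∈ shortGaps

  apart? : ∀ p q → Dec (Apart p q)
  apart? (s , c) (s′ , c′) = ¬? (s ≟ₛ s′) ⊎-dec (∣ c - c′ ∣ ∈? shortGaps)

  apart⇒≢ : ∀ {p q} x → Apart p q → ⟦ p ⟧ x ≢ ⟦ q ⟧ x
  apart⇒≢ {s , c} {s′ , c′} x (inj₁ s≢s′) eq = s≢s′ (at-side {x = c + x} {c′ + x} eq)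
  apart⇒≢ {s , c} {s′ , c′} x (inj₂ gap)   eq with at-side {x = c + x} {c′ + x} eq
  ... | refl = All.lookup (shortGaps-nonmultiples k n≢6 n≢8) gap (%≡%⇒∣∣-∣ {x = c} {c′} c≡c′)
    where
    c≡c′ : c % n ≡ c′ % n
    c≡c′ = %-cancelˡ x (subst₂ (λ y z → y % n ≡ z % n) (+-comm c x) (+-comm c′ x)
                                (at-injective s {c + x} {c′ + x} eq))

  -- the closed neighbourhood of the local vertex (s , 2 + c)
  nbhd : Side → ℕ → List Local
  nbhd outer c = (outer , 2 + c) ∷ (outer , 3 + c) ∷ (outer , 1 + c) ∷ (inner , 2 + c) ∷ []
  nbhd inner c = (inner , 2 + c) ∷ (inner , 4 + c) ∷ (inner , c) ∷ (outer , 2 + c) ∷ []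

  nbhd-complete : ∀ s c x {v} → Step G (⟦ s , 2 + c ⟧ x) v → v ∈ map (λ p → ⟦ p ⟧ x) (nbhd s c)
  nbhd-complete outer c x s = ≡⊎≡⊎≡⊎≡⇒∈ (outer-nbhd (1 + c + x) s)
  nbhd-complete inner c x s = ≡⊎≡⊎≡⊎≡⇒∈ (inner-nbhd (c + x) s)

  MeetOnlyAt : Local → List Local → List Local → Set
  MeetOnlyAt r P Q = All.All (λ p → All.All (λ q → p ≡ r ⊎ Apart p q) Q) P

  meetOnlyAt? : ∀ r P Q → Dec (MeetOnlyAt r P Q)
  meetOnlyAt? r P Q = All.all? (λ p → All.all? (λ q → (p ≟ₗ r) ⊎-dec apart? p q) Q) P

  -- Girth five around r, reduced to a finite check on offsets that is discharged by
  -- normalising meetOnlyAt?.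
  meet : ∀ r s c s′ c′ {_ : True (meetOnlyAt? r (nbhd s c) (nbhd s′ c′))} x {z} →
         Step G z (⟦ s , 2 + c ⟧ x) → Step G z (⟦ s′ , 2 + c′ ⟧ x) → z ≡ ⟦ r ⟧ x
  meet r s c s′ c′ {check} x z→u z→u′
    with ∈-map⁻ _ (nbhd-complete s c x (step-sym z→u))
       | ∈-map⁻ _ (nbhd-complete s′ c′ x (step-sym z→u′))
  ... | p , p∈ , z≡p | q , q∈ , z≡q with All.lookup (All.lookup (toWitness check) p∈) q∈
  ...   | inj₁ refl  = z≡p
  ...   | inj₂ apart = ⊥-elim (apart⇒≢ {p} {q} x apart (trans (sym z≡p) z≡q))

  branching-at : ∀ s x → Branching (⟦ s , 4 ⟧ x)
  branching-at outer x = record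
    { r→u₁   = outer-edge (4 + x)
    ; r→u₂   = step-sym (outer-edge (3 + x))
    ; r→u₃   = spoke (4 + x)
    ; meet₁₂ = meet (outer , 4) outer 3 outer 1 x
    ; meet₁₃ = meet (outer , 4) outer 3 inner 2 x
    ; meet₂₃ = meet (outer , 4) outer 1 inner 2 x
    }
  branching-at inner x = record
    { r→u₁   = inner-edge (4 + x)
    ; r→u₂   = step-sym (inner-edge (2 + x))
    ; r→u₃   = step-sym (spoke (4 + x))
    ; meet₁₂ = meet (inner , 4) inner 4 inner 0 x
    ; meet₁₃ = meet (inner , 4) inner 4 outer 2 x
    ; meet₂₃ = meet (inner , 4) inner 0 outer 2 x
    }

  -- Vertex i sits at offset 4 from the base 1 + k + i, since 4 + (1 + k + i) = n + i.
  branching : ∀ v → Branching v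
  branching (inj₁ i) =
    subst Branching (trans (at-periodic outer (toℕ i)) (at-toℕ outer i)) (branching-at outer (suc k + toℕ i))
  branching (inj₂ i) =
    subst Branching (trans (at-periodic inner (toℕ i)) (at-toℕ inner i)) (branching-at inner (suc k + toℕ i))

  distinct : ∀ p q {_ : True (apart? p q)} → ⟦ p ⟧ 0 ≢ ⟦ q ⟧ 0
  distinct p q {apart} = apart⇒≢ {p} {q} 0 (toWitness apart)

  two-cops-lose-GP : ¬ CopsWinGame G 2
  two-cops-lose-GP = two-cops-lose branching
    (avoid-two _≟ᵥ_ (distinct (outer , 0) (outer , 1)) (distinct (outer , 0) (outer , 2))
                    (distinct (outer , 1) (outer , 2)))

  fewer-cops-lose : ∀ c → c < 3 → ¬ CopsWinGame G c
  fewer-cops-lose c c<3 = two-cops-lose-GP ∘ CopsWinGame-mono 2 (s≤s⁻¹ c<3) (a 0)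

proposition2p2 : ((n : ℕ) → 5 ≤ n → CopNumber≤ (GP n 2) 3)
                 × ((n : ℕ) → 5 ≤ n → ¬ (n ≡ 6) → ¬ (n ≡ 8) → CopNumber≡ (GP n 2) 3)
proposition2p2 = at-most-three , exactly-three
  where
  at-most-three : (n : ℕ) → 5 ≤ n → CopNumber≤ (GP n 2) 3
  at-most-three .(5 + k) (s≤s (s≤s (s≤s (s≤s (s≤s {n = k} _))))) =
    3 , ≤-refl , UpperBound.three-cops-win k

  exactly-three : (n : ℕ) → 5 ≤ n → ¬ (n ≡ 6) → ¬ (n ≡ 8) → CopNumber≡ (GP n 2) 3
  exactly-three .(5 + k) (s≤s (s≤s (s≤s (s≤s (s≤s {n = k} _))))) n≢6 n≢8 =
    UpperBound.three-cops-win k , LowerBound.fewer-cops-lose k n≢6 n≢8
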